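{- $E_{\mathsf{ftc-cm}}\vdash 0\cdot x=\frac{1}{y}\to x=\bot$.
   Context: $\Sigma$ is the signature with constants $0,1,\bot$, unary $-$, binary $+,\cdot,\div$; $x\div y$ is written $\frac{x}{y}$. $E_{\mathsf{ftc-cm}}$ is the following set of equations: $(x+y)+z=x+(y+z)$; $x+y=y+x$; $x+0=x$; $x+(-x)=0\cdot x$; $x\cdot(y\cdot z)=(x\cdot y)\cdot z$; $x\cdot y=y\cdot x$; $1\cdot x=x$; $x\cdot(y+z)=(x\cdot y)+(x\cdot z)$; $-(-x)=x$; $0\cdot(x\cdot x)=0\cdot x$; $x+\bot=\bot$; $x=\frac{x}{1}$; $\frac{x}{y}\cdot\frac{u}{v}=\frac{x\cdot u}{y\cdot v}$; $\frac{x}{y}+\frac{u}{v}=\frac{(x\cdot v)+(y\cdot u)}{y\cdot v}$; $\frac{x}{y+(0\cdot z)}=\frac{x+(0\cdot z)}{y}$; $\bot=\frac{1}{0}$. $\vdash$ is derivability in conditional equational logic (equivalently first order logic). -}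

module Defs where

open import Level using (Level; suc)
open import Relation.Binary.PropositionalEquality using (_≡_)

-- A Σ-algebra (Σ = {0,1,⊥,-,+,·,÷}) satisfying all equations of E_ftc-cm,
-- i.e. a first-order model of E_ftc-cm (equality interpreted as identity).
-- x ÷ y is the paper's fraction x / y.
record FtcCmModel (ℓ : Level) : Set (suc ℓ) where
  infixl 6 _+_
  infixl 7 _·_
  infixl 7 _÷_
  field
    Carrier : Set ℓ
    𝟎 𝟏 ⊥ : Carrier
    -_ : Carrier → Carrier
    _+_ _·_ _÷_ : Carrier → Carrier → Carrier
    +-assoc   : ∀ x y z → (x + y) + z ≡ x + (y + z)
    +-comm    : ∀ x y → x + y ≡ y + x
    +-idʳ     : ∀ x → x + 𝟎 ≡ x
    +-inv     : ∀ x → x + (- x) ≡ 𝟎 · x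
    ·-assoc   : ∀ x y z → x · (y · z) ≡ (x · y) · z
    ·-comm    : ∀ x y → x · y ≡ y · x
    ·-idˡ     : ∀ x → 𝟏 · x ≡ x
    ·-distrib : ∀ x y z → x · (y + z) ≡ (x · y) + (x · z)
    neg-inv   : ∀ x → - (- x) ≡ x
    0·sq      : ∀ x → 𝟎 · (x · x) ≡ 𝟎 · x
    +-⊥       : ∀ x → x + ⊥ ≡ ⊥
    ÷-one     : ∀ x → x ≡ x ÷ 𝟏
    ÷-mul     : ∀ x y u v → (x ÷ y) · (u ÷ v) ≡ (x · u) ÷ (y · v)
    ÷-add     : ∀ x y u v → (x ÷ y) + (u ÷ v) ≡ ((x · v) + (y · u)) ÷ (y · v)
    ÷-shift   : ∀ x y z → x ÷ (y + (𝟎 · z)) ≡ (x + (𝟎 · z)) ÷ y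
    ⊥-def     : ⊥ ≡ 𝟏 ÷ 𝟎

{-# OPTIONS --safe #-}
module Submission where

open import Defs
open import Level using (Level)
open import Relation.Binary.PropositionalEquality
  using (_≡_; sym; trans; cong; cong₂; module ≡-Reasoning)

-- Put t = 0·x = 1/y.  Both t and y·t are fixed by 0·_, and y·t = y·(1/y) = 1 + t,
-- so 1 + t = 0·(1 + t) = t.  Hence t = 1 + 0·t = 1/(1 + 0·t) = 1/t = 1/(0·x) = ⊥,
-- and x = x + 0·x = x + ⊥ = ⊥.

module FtcCmProperties {ℓ : Level} (M : FtcCmModel ℓ) where
  open FtcCmModel M
  open ≡-Reasoning

  ·-idʳ : ∀ x → x · 𝟏 ≡ x
  ·-idʳ x = trans (·-comm x 𝟏) (·-idˡ x)

  +-idˡ : ∀ x → 𝟎 + x ≡ x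
  +-idˡ x = trans (+-comm 𝟎 x) (+-idʳ x)

  x+0·x≡x : ∀ x → x + 𝟎 · x ≡ x
  x+0·x≡x x = begin
    x + 𝟎 · x      ≡⟨ cong₂ _+_ (sym (·-idʳ x)) (·-comm 𝟎 x) ⟩
    x · 𝟏 + x · 𝟎  ≡⟨ sym (·-distrib x 𝟏 𝟎) ⟩
    x · (𝟏 + 𝟎)    ≡⟨ cong (x ·_) (+-idʳ 𝟏) ⟩
    x · 𝟏          ≡⟨ ·-idʳ x ⟩
    x              ∎

  0·0≡0 : 𝟎 · 𝟎 ≡ 𝟎
  0·0≡0 = trans (sym (+-idˡ (𝟎 · 𝟎))) (x+0·x≡x 𝟎)

  0·-idem : ∀ z → 𝟎 · (𝟎 · z) ≡ 𝟎 · z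
  0·-idem z = trans (·-assoc 𝟎 𝟎 z) (cong (_· z) 0·0≡0)

  0·-fixed-·ˡ : ∀ b {a} → 𝟎 · a ≡ a → 𝟎 · (b · a) ≡ b · a
  0·-fixed-·ˡ b {a} 0a≡a = begin
    𝟎 · (b · a)  ≡⟨ ·-assoc 𝟎 b a ⟩
    (𝟎 · b) · a  ≡⟨ cong (_· a) (·-comm 𝟎 b) ⟩
    (b · 𝟎) · a  ≡⟨ sym (·-assoc b 𝟎 a) ⟩
    b · (𝟎 · a)  ≡⟨ cong (b ·_) 0a≡a ⟩
    b · a        ∎

  ·-1÷ : ∀ x y → x · (𝟏 ÷ y) ≡ x ÷ y
  ·-1÷ x y = begin
    x · (𝟏 ÷ y)        ≡⟨ cong (_· (𝟏 ÷ y)) (÷-one x) ⟩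
    (x ÷ 𝟏) · (𝟏 ÷ y)  ≡⟨ ÷-mul x 𝟏 𝟏 y ⟩
    (x · 𝟏) ÷ (𝟏 · y)  ≡⟨ cong₂ _÷_ (·-idʳ x) (·-idˡ y) ⟩
    x ÷ y              ∎

  y÷y≡1+0÷y : ∀ y → y ÷ y ≡ 𝟏 + 𝟎 ÷ y
  y÷y≡1+0÷y y = begin
    y ÷ y                      ≡⟨ cong (_÷ y) (sym (+-idʳ y)) ⟩
    (y + 𝟎) ÷ y                ≡⟨ cong₂ (λ a b → (a + b) ÷ y) (sym (·-idˡ y)) (sym (·-idˡ 𝟎)) ⟩
    (𝟏 · y + 𝟏 · 𝟎) ÷ y        ≡⟨ cong ((𝟏 · y + 𝟏 · 𝟎) ÷_) (sym (·-idˡ y)) ⟩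
    (𝟏 · y + 𝟏 · 𝟎) ÷ (𝟏 · y)  ≡⟨ sym (÷-add 𝟏 𝟏 𝟎 y) ⟩
    𝟏 ÷ 𝟏 + 𝟎 ÷ y              ≡⟨ cong (_+ 𝟎 ÷ y) (sym (÷-one 𝟏)) ⟩
    𝟏 + 𝟎 ÷ y                  ∎

  y·1÷y≡1+0·1÷y : ∀ y → y · (𝟏 ÷ y) ≡ 𝟏 + 𝟎 · (𝟏 ÷ y)
  y·1÷y≡1+0·1÷y y = begin
    y · (𝟏 ÷ y)      ≡⟨ ·-1÷ y y ⟩
    y ÷ y            ≡⟨ y÷y≡1+0÷y y ⟩
    𝟏 + 𝟎 ÷ y        ≡⟨ cong (𝟏 +_) (sym (·-1÷ 𝟎 y)) ⟩
    𝟏 + 𝟎 · (𝟏 ÷ y)  ∎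

  y·a≡1+a : ∀ y {a} → 𝟎 · a ≡ a → a ≡ 𝟏 ÷ y → y · a ≡ 𝟏 + a
  y·a≡1+a y {a} 0a≡a a≡1÷y = begin
    y · a            ≡⟨ cong (y ·_) a≡1÷y ⟩
    y · (𝟏 ÷ y)      ≡⟨ y·1÷y≡1+0·1÷y y ⟩
    𝟏 + 𝟎 · (𝟏 ÷ y)  ≡⟨ cong (λ b → 𝟏 + 𝟎 · b) (sym a≡1÷y) ⟩
    𝟏 + 𝟎 · a        ≡⟨ cong (𝟏 +_) 0a≡a ⟩
    𝟏 + a            ∎

  ÷-1+0· : ∀ x z → x ÷ (𝟏 + 𝟎 · z) ≡ x + 𝟎 · z
  ÷-1+0· x z = trans (÷-shift x 𝟏 z) (sym (÷-one (x + 𝟎 · z)))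

  1÷0·z≡⊥ : ∀ z → 𝟏 ÷ (𝟎 · z) ≡ ⊥
  1÷0·z≡⊥ z = begin
    𝟏 ÷ (𝟎 · z)                          ≡⟨ cong (𝟏 ÷_) (sym (+-idˡ (𝟎 · z))) ⟩
    𝟏 ÷ (𝟎 + 𝟎 · z)                      ≡⟨ ÷-shift 𝟏 𝟎 z ⟩
    (𝟏 + 𝟎 · z) ÷ 𝟎                      ≡⟨ cong₂ (λ a b → (a + b) ÷ 𝟎) (sym (·-idʳ 𝟏)) (sym (0·-idem z)) ⟩
    (𝟏 · 𝟏 + 𝟎 · (𝟎 · z)) ÷ 𝟎            ≡⟨ cong ((𝟏 · 𝟏 + 𝟎 · (𝟎 · z)) ÷_) (sym (·-idʳ 𝟎)) ⟩
    (𝟏 · 𝟏 + 𝟎 · (𝟎 · z)) ÷ (𝟎 · 𝟏)      ≡⟨ sym (÷-add 𝟏 𝟎 (𝟎 · z) 𝟏) ⟩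
    𝟏 ÷ 𝟎 + (𝟎 · z) ÷ 𝟏                  ≡⟨ cong₂ _+_ (sym ⊥-def) (sym (÷-one (𝟎 · z))) ⟩
    ⊥ + 𝟎 · z                            ≡⟨ +-comm ⊥ (𝟎 · z) ⟩
    𝟎 · z + ⊥                            ≡⟨ +-⊥ (𝟎 · z) ⟩
    ⊥                                    ∎

  1+a≡a : ∀ {a} → 𝟎 · a ≡ a → 𝟎 · (𝟏 + a) ≡ 𝟏 + a → 𝟏 + a ≡ a
  1+a≡a {a} 0a≡a 0[1+a]≡1+a = begin
    𝟏 + a          ≡⟨ sym 0[1+a]≡1+a ⟩
    𝟎 · (𝟏 + a)    ≡⟨ ·-distrib 𝟎 𝟏 a ⟩
    𝟎 · 𝟏 + 𝟎 · a  ≡⟨ cong₂ _+_ (·-idʳ 𝟎) 0a≡a ⟩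
    𝟎 + a          ≡⟨ +-idˡ a ⟩
    a              ∎

  0·-fixed∧1+a≡a⇒a≡⊥ : ∀ {a} → 𝟎 · a ≡ a → 𝟏 + a ≡ a → a ≡ ⊥
  0·-fixed∧1+a≡a⇒a≡⊥ {a} 0a≡a 1+a≡a = begin
    a                ≡⟨ sym 1+a≡a ⟩
    𝟏 + a            ≡⟨ cong (𝟏 +_) (sym 0a≡a) ⟩
    𝟏 + 𝟎 · a        ≡⟨ sym (÷-1+0· 𝟏 a) ⟩
    𝟏 ÷ (𝟏 + 𝟎 · a)  ≡⟨ cong (λ b → 𝟏 ÷ (𝟏 + b)) 0a≡a ⟩
    𝟏 ÷ (𝟏 + a)      ≡⟨ cong (𝟏 ÷_) 1+a≡a ⟩
    𝟏 ÷ a            ≡⟨ cong (𝟏 ÷_) (sym 0a≡a) ⟩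
    𝟏 ÷ (𝟎 · a)      ≡⟨ 1÷0·z≡⊥ a ⟩
    ⊥                ∎

mainTheorem14 : ∀ {ℓ : Level} (M : FtcCmModel ℓ) → let open FtcCmModel M in
    ∀ (x y : Carrier) → 𝟎 · x ≡ 𝟏 ÷ y → x ≡ ⊥
mainTheorem14 M x y 0x≡1÷y = begin
    x          ≡⟨ sym (x+0·x≡x x) ⟩
    x + 𝟎 · x  ≡⟨ cong (x +_) 0x≡⊥ ⟩
    x + ⊥      ≡⟨ +-⊥ x ⟩
    ⊥          ∎
  where
  open FtcCmModel M
  open FtcCmProperties M
  open ≡-Reasoning

  y·0x≡1+0x : y · (𝟎 · x) ≡ 𝟏 + 𝟎 · x
  y·0x≡1+0x = y·a≡1+a y (0·-idem x) 0x≡1÷y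

  0·-fixed-1+0x : 𝟎 · (𝟏 + 𝟎 · x) ≡ 𝟏 + 𝟎 · x
  0·-fixed-1+0x = begin
    𝟎 · (𝟏 + 𝟎 · x)    ≡⟨ cong (𝟎 ·_) (sym y·0x≡1+0x) ⟩
    𝟎 · (y · (𝟎 · x))  ≡⟨ 0·-fixed-·ˡ y (0·-idem x) ⟩
    y · (𝟎 · x)        ≡⟨ y·0x≡1+0x ⟩
    𝟏 + 𝟎 · x          ∎

  0x≡⊥ : 𝟎 · x ≡ ⊥
  0x≡⊥ = 0·-fixed∧1+a≡a⇒a≡⊥ (0·-idem x) (1+a≡a (0·-idem x) 0·-fixed-1+0x)
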